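{- Let $A$ be a finite set and $G\le\mathrm{Sym}(A)$. Then $\prod_{P\in\mathrm{SP}_A(G),|P|<5}\mathrm{Sym}(P)\times\prod_{P\in\mathrm{SP}_A(G),|P|\ge5}\mathrm{Alt}(P)\le G\le\mathrm{Stab}(\mathrm{SP}_A(G))$, where $\mathrm{Stab}(\mathcal{P})$ is the group of all $\pi\in\mathrm{Sym}(A)$ with $\pi\mathcal{P}=\mathcal{P}$ (i.e. $\pi$ maps every part of $\mathcal{P}$ onto a part of $\mathcal{P}$).
   Context: An alternating supporting partition of $G\le\mathrm{Sym}(A)$ is a partition $\mathcal{P}$ of $A$ such that $\prod_{P\in\mathcal{P},|P|<5}\mathrm{Sym}(P)\times\prod_{P\in\mathcal{P},|P|\ge5}\mathrm{Alt}(P)\le G$ (each factor acting on its part and fixing all other points). Every $G$ has a unique coarsest alternating supporting partition (every alternating supporting partition of $G$ refines it), denoted $\mathrm{SP}_A(G)$. -}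

module Defs where

open import Level using (0ℓ)
open import Data.Nat using (ℕ; zero; suc; _<_; _≥_)
open import Data.Fin using (Fin; _≟_)
open import Data.Fin.Permutation
  using (Permutation′; _⟨$⟩ʳ_; _≈_; id; flip; _∘ₚ_; transpose)
open import Data.List using (List; []; _∷_; length; filter; foldr; allFin)
open import Data.List.Relation.Unary.All using (All)
open import Data.Product using (Σ; ∃; _×_; _,_)
open import Function.Bundles using (_⇔_)
open import Relation.Binary.PropositionalEquality using (_≡_; _≢_)

Perm : ℕ → Set
Perm n = Permutation′ n

record IsSubgroup {n : ℕ} (G : Perm n → Set) : Set where
  field
    respects : ∀ {π ρ} → π ≈ ρ → G π → G ρ
    has-id   : G id
    closed-∘ : ∀ {π ρ} → G π → G ρ → G (π ∘ₚ ρ)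
    closed-⁻¹ : ∀ {π} → G π → G (flip π)

-- A partition of Fin n is given by a labelling 𝒫 : Fin n → Fin n;
-- the parts are the non-empty fibres  { a | 𝒫 a ≡ i }.
Partition : ℕ → Set
Partition n = Fin n → Fin n

part : ∀ {n} → Partition n → Fin n → List (Fin n)
part 𝒫 i = filter (λ a → 𝒫 a ≟ i) (allFin _)

partSize : ∀ {n} → Partition n → Fin n → ℕ
partSize 𝒫 i = length (part 𝒫 i)

SupportedOn : ∀ {n} → Partition n → Fin n → Perm n → Set
SupportedOn 𝒫 i π = ∀ a → 𝒫 a ≢ i → π ⟨$⟩ʳ a ≡ a

prodTransp : ∀ {n} → List (Fin n × Fin n) → Perm n
prodTransp = foldr (λ { (x , y) acc → transpose x y ∘ₚ acc }) id

data EvenLength {A : Set} : List A → Set where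
  nil  : EvenLength []
  cons : ∀ {x y xs} → EvenLength xs → EvenLength (x ∷ y ∷ xs)

TranspIn : ∀ {n} → Partition n → Fin n → Fin n × Fin n → Set
TranspIn 𝒫 i (x , y) = (x ≢ y) × (𝒫 x ≡ i) × (𝒫 y ≡ i)

InSym : ∀ {n} → Partition n → Fin n → Perm n → Set
InSym 𝒫 i π = SupportedOn 𝒫 i π

InAlt : ∀ {n} → Partition n → Fin n → Perm n → Set
InAlt {n} 𝒫 i π = Σ (List (Fin n × Fin n)) λ ts →
  EvenLength ts × All (TranspIn 𝒫 i) ts × (π ≈ prodTransp ts)

InFactor : ∀ {n} → Partition n → Fin n → Perm n → Set
InFactor 𝒫 i π =
  (partSize 𝒫 i < 5 → InSym 𝒫 i π) × (partSize 𝒫 i ≥ 5 → InAlt 𝒫 i π)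

prodFamily : ∀ {n} → (Fin n → Perm n) → Perm n
prodFamily {n} σ = foldr (λ i acc → σ i ∘ₚ acc) id (allFin n)

-- π lies in  ∏_{|P|<5} Sym(P) × ∏_{|P|≥5} Alt(P)
-- (empty labels contribute Sym(∅) = 1)
InProduct : ∀ {n} → Partition n → Perm n → Set
InProduct {n} 𝒫 π = Σ (Fin n → Perm n) λ σ →
  (∀ i → InFactor 𝒫 i (σ i)) × (π ≈ prodFamily σ)

IsASP : ∀ {n} → (Perm n → Set) → Partition n → Set
IsASP G 𝒫 = ∀ π → InProduct 𝒫 π → G π

Refines : ∀ {n} → Partition n → Partition n → Set
Refines 𝒬 𝒫 = ∀ a b → 𝒬 a ≡ 𝒬 b → 𝒫 a ≡ 𝒫 b

-- 𝒫 = SP_A(G): an alternating supporting partition that every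
-- alternating supporting partition of G refines
IsCoarsestASP : ∀ {n} → (Perm n → Set) → Partition n → Set
IsCoarsestASP G 𝒫 = IsASP G 𝒫 × (∀ 𝒬 → IsASP G 𝒬 → Refines 𝒬 𝒫)

-- π ∈ Stab(𝒫): π maps every part of 𝒫 onto a part of 𝒫, i.e. for the part
-- containing a there is a part (that containing c) equal to its image
InStab : ∀ {n} → Partition n → Perm n → Set
InStab {n} 𝒫 π = ∀ a → Σ (Fin n) λ c → ∀ b →
  (𝒫 b ≡ 𝒫 c) ⇔ (Σ (Fin n) λ d → (𝒫 d ≡ 𝒫 a) × (π ⟨$⟩ʳ d ≡ b))

{-# OPTIONS --safe #-}
module Submission where

-- Write π⁻¹𝒫 for the partition whose parts are the preimages π⁻¹(P) of the
-- parts P of 𝒫. Conjugation by π carries the subgroup ∏ Sym/Alt attached to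
-- π⁻¹𝒫 onto the one attached to 𝒫 (it maps transpositions inside π⁻¹(P) to
-- transpositions inside P, and |π⁻¹(P)| = |P|). So if π ∈ G and 𝒫 is an
-- alternating supporting partition of G, so is π⁻¹𝒫. For the coarsest one,
-- π⁻¹𝒫 and likewise π𝒫 refine 𝒫; both refinements together say that π
-- maps every part of 𝒫 onto a part of 𝒫.

open import Defs
open import Algebra.Properties.CommutativeMonoid.Sum using (sum; sum-permute)
open import Data.Bool using (true; false; if_then_else_)
open import Data.Fin using (Fin; zero; suc; _≟_)
open import Data.Fin.Permutation
  using (_⟨$⟩ʳ_; _⟨$⟩ˡ_; _≈_; id; flip; _∘ₚ_; transpose; inverseˡ; inverseʳ)
import Data.Fin.Permutation.Components as Components
open import Data.List using (List; []; _∷_; length; filter; map; tabulate; foldr; allFin)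
open import Data.List.Relation.Unary.All using (All; []; _∷_)
open import Data.Nat using (ℕ; zero; suc; _<_; _≥_)
open import Data.Nat.Properties using (+-0-commutativeMonoid)
open import Data.Product using (Σ; _×_; _,_)
open import Function using (_∘_; Injective)
open import Function.Bundles using (Injection; mk⇔)
open import Function.Properties.Inverse using (↔⇒↣)
open import Relation.Binary.PropositionalEquality
open import Relation.Nullary using (Dec; yes; no; does)
open import Relation.Nullary.Decidable using (dec-true; dec-false)
open import Relation.Unary using (Pred; Decidable)

private
  variable
    n : ℕ

length-filter-tabulate : ∀ {a p} {A : Set a} {P : Pred A p} (P? : Decidable P)
  {m} (g : Fin m → A) →
  length (filter P? (tabulate g)) ≡
  sum +-0-commutativeMonoid (λ k → if does (P? (g k)) then 1 else 0)
length-filter-tabulate P? {zero} g = refl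
length-filter-tabulate P? {suc m} g with does (P? (g zero))
... | true  = cong suc (length-filter-tabulate P? (g ∘ suc))
... | false = length-filter-tabulate P? (g ∘ suc)

module _ {x y k : Fin n} where

  transpose-matchˡ : k ≡ x → Components.transpose x y k ≡ y
  transpose-matchˡ k≡x rewrite dec-true (k ≟ x) k≡x = refl

  transpose-matchʳ : k ≢ x → k ≡ y → Components.transpose x y k ≡ x
  transpose-matchʳ k≢x k≡y rewrite dec-false (k ≟ x) k≢x | dec-true (k ≟ y) k≡y = refl

  transpose-mismatch : k ≢ x → k ≢ y → Components.transpose x y k ≡ k
  transpose-mismatch k≢x k≢y rewrite dec-false (k ≟ x) k≢x | dec-false (k ≟ y) k≢y = refl

transpose-natural : ∀ {m} (f : Fin n → Fin m) → Injective _≡_ _≡_ f →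
  ∀ x y k → f (Components.transpose x y k) ≡ Components.transpose (f x) (f y) (f k)
transpose-natural f f-inj x y k = by-cases (k ≟ x) (k ≟ y)
  where
  by-cases : Dec (k ≡ x) → Dec (k ≡ y) →
    f (Components.transpose x y k) ≡ Components.transpose (f x) (f y) (f k)
  by-cases (yes k≡x) _ =
    trans (cong f (transpose-matchˡ k≡x)) (sym (transpose-matchˡ (cong f k≡x)))
  by-cases (no k≢x) (yes k≡y) =
    trans (cong f (transpose-matchʳ k≢x k≡y))
          (sym (transpose-matchʳ (k≢x ∘ f-inj) (cong f k≡y)))
  by-cases (no k≢x) (no k≢y) =
    trans (cong f (transpose-mismatch k≢x k≢y))
          (sym (transpose-mismatch (k≢x ∘ f-inj) (k≢y ∘ f-inj)))

evenLength-map : ∀ {A B : Set} (f : A → B) {xs : List A} →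
  EvenLength xs → EvenLength (map f xs)
evenLength-map f nil      = nil
evenLength-map f (cons e) = cons (evenLength-map f e)

pullback : Perm n → Partition n → Partition n
pullback π 𝒫 a = 𝒫 (π ⟨$⟩ʳ a)

partSize-pullback : (π : Perm n) (𝒫 : Partition n) (i : Fin n) →
  partSize (pullback π 𝒫) i ≡ partSize 𝒫 i
partSize-pullback π 𝒫 i = begin
  partSize (pullback π 𝒫) i
    ≡⟨ length-filter-tabulate (λ a → 𝒫 (π ⟨$⟩ʳ a) ≟ i) (λ a → a) ⟩
  sum +-0-commutativeMonoid (indicator ∘ (π ⟨$⟩ʳ_))
    ≡⟨ sum-permute +-0-commutativeMonoid indicator π ⟨
  sum +-0-commutativeMonoid indicator
    ≡⟨ length-filter-tabulate (λ a → 𝒫 a ≟ i) (λ a → a) ⟨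
  partSize 𝒫 i ∎
  where
  open ≡-Reasoning
  indicator : Fin _ → ℕ
  indicator a = if does (𝒫 a ≟ i) then 1 else 0

prodOver : (Fin n → Perm n) → List (Fin n) → Perm n
prodOver σ is = foldr (λ i acc → σ i ∘ₚ acc) id is

-- The map x ↦ π (σ (π⁻¹ x)): _∘ₚ_ composes from left to right.
conjugate : Perm n → Perm n → Perm n
conjugate π σ = flip π ∘ₚ σ ∘ₚ π

module _ (π : Perm n) where
  open ≡-Reasoning

  ⟨$⟩ʳ-injective : Injective _≡_ _≡_ (π ⟨$⟩ʳ_)
  ⟨$⟩ʳ-injective = Injection.injective (↔⇒↣ π)

  conjugate-cong : ∀ {σ τ} → σ ≈ τ → conjugate π σ ≈ conjugate π τ
  conjugate-cong σ≈τ x = cong (π ⟨$⟩ʳ_) (σ≈τ (π ⟨$⟩ˡ x))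

  conjugate-∘ₚ : ∀ σ τ x →
    conjugate π (σ ∘ₚ τ) ⟨$⟩ʳ x ≡ (conjugate π σ ∘ₚ conjugate π τ) ⟨$⟩ʳ x
  conjugate-∘ₚ σ τ x = cong (λ z → π ⟨$⟩ʳ (τ ⟨$⟩ʳ z)) (sym (inverseˡ π))

  conjugate-transpose : ∀ x y → conjugate π (transpose x y) ≈ transpose (π ⟨$⟩ʳ x) (π ⟨$⟩ʳ y)
  conjugate-transpose x y z = begin
    π ⟨$⟩ʳ Components.transpose x y (π ⟨$⟩ˡ z)
      ≡⟨ transpose-natural (π ⟨$⟩ʳ_) ⟨$⟩ʳ-injective x y (π ⟨$⟩ˡ z) ⟩
    Components.transpose (π ⟨$⟩ʳ x) (π ⟨$⟩ʳ y) (π ⟨$⟩ʳ (π ⟨$⟩ˡ z))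
      ≡⟨ cong (Components.transpose (π ⟨$⟩ʳ x) (π ⟨$⟩ʳ y)) (inverseʳ π) ⟩
    Components.transpose (π ⟨$⟩ʳ x) (π ⟨$⟩ʳ y) z
      ∎

  map-pair : Fin n × Fin n → Fin n × Fin n
  map-pair (x , y) = π ⟨$⟩ʳ x , π ⟨$⟩ʳ y

  conjugate-prodTransp : ∀ ts → conjugate π (prodTransp ts) ≈ prodTransp (map map-pair ts)
  conjugate-prodTransp []             z = inverseʳ π
  conjugate-prodTransp ((x , y) ∷ ts) z = begin
    conjugate π (transpose x y ∘ₚ prodTransp ts) ⟨$⟩ʳ z
      ≡⟨ conjugate-∘ₚ (transpose x y) (prodTransp ts) z ⟩
    conjugate π (prodTransp ts) ⟨$⟩ʳ (conjugate π (transpose x y) ⟨$⟩ʳ z)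
      ≡⟨ conjugate-prodTransp ts _ ⟩
    prodTransp (map map-pair ts) ⟨$⟩ʳ (conjugate π (transpose x y) ⟨$⟩ʳ z)
      ≡⟨ cong (prodTransp (map map-pair ts) ⟨$⟩ʳ_) (conjugate-transpose x y z) ⟩
    prodTransp (map map-pair ((x , y) ∷ ts)) ⟨$⟩ʳ z
      ∎

  conjugate-prodOver : ∀ (σ : Fin n → Perm n) is →
    conjugate π (prodOver σ is) ≈ prodOver (conjugate π ∘ σ) is
  conjugate-prodOver σ []       z = inverseʳ π
  conjugate-prodOver σ (i ∷ is) z = begin
    conjugate π (σ i ∘ₚ prodOver σ is) ⟨$⟩ʳ z
      ≡⟨ conjugate-∘ₚ (σ i) (prodOver σ is) z ⟩
    conjugate π (prodOver σ is) ⟨$⟩ʳ (conjugate π (σ i) ⟨$⟩ʳ z)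
      ≡⟨ conjugate-prodOver σ is _ ⟩
    prodOver (conjugate π ∘ σ) (i ∷ is) ⟨$⟩ʳ z
      ∎

  conjugate-inverse : ∀ σ → conjugate (flip π) (conjugate π σ) ≈ σ
  conjugate-inverse σ x = begin
    π ⟨$⟩ˡ (π ⟨$⟩ʳ (σ ⟨$⟩ʳ (π ⟨$⟩ˡ (π ⟨$⟩ʳ x))))  ≡⟨ inverseˡ π ⟩
    σ ⟨$⟩ʳ (π ⟨$⟩ˡ (π ⟨$⟩ʳ x))                    ≡⟨ cong (σ ⟨$⟩ʳ_) (inverseˡ π) ⟩
    σ ⟨$⟩ʳ x                                      ∎

  module _ (𝒫 : Partition n) where

    supportedOn-pullback : ∀ {i σ} → SupportedOn (pullback π 𝒫) i σ →
      SupportedOn 𝒫 i (conjugate π σ)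
    supportedOn-pullback {i} {σ} σ-supp a 𝒫a≢i = begin
      π ⟨$⟩ʳ (σ ⟨$⟩ʳ (π ⟨$⟩ˡ a))
        ≡⟨ cong (π ⟨$⟩ʳ_) (σ-supp (π ⟨$⟩ˡ a) (𝒫a≢i ∘ trans (cong 𝒫 (sym (inverseʳ π))))) ⟩
      π ⟨$⟩ʳ (π ⟨$⟩ˡ a)
        ≡⟨ inverseʳ π ⟩
      a ∎

    transpIn-pullback : ∀ {i} p → TranspIn (pullback π 𝒫) i p → TranspIn 𝒫 i (map-pair p)
    transpIn-pullback (x , y) (x≢y , 𝒫πx≡i , 𝒫πy≡i) = x≢y ∘ ⟨$⟩ʳ-injective , 𝒫πx≡i , 𝒫πy≡i

    inAlt-pullback : ∀ {i σ} → InAlt (pullback π 𝒫) i σ → InAlt 𝒫 i (conjugate π σ)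
    inAlt-pullback {σ = σ} (ts , even , inside , σ≈ts) =
      map map-pair ts , evenLength-map map-pair even , mapAll inside ,
      λ z → trans (conjugate-cong {σ} {prodTransp ts} σ≈ts z) (conjugate-prodTransp ts z)
      where
      mapAll : ∀ {i ts} → All (TranspIn (pullback π 𝒫) i) ts → All (TranspIn 𝒫 i) (map map-pair ts)
      mapAll []             = []
      mapAll (t∈P ∷ inside) = transpIn-pullback _ t∈P ∷ mapAll inside

    inFactor-pullback : ∀ i σ → InFactor (pullback π 𝒫) i σ → InFactor 𝒫 i (conjugate π σ)
    inFactor-pullback i σ (small⇒sym , large⇒alt) =
      (λ small → supportedOn-pullback {i} {σ} (small⇒sym (subst (_< 5) (sym size≡) small))) ,
      (λ large → inAlt-pullback {i} {σ} (large⇒alt (subst (_≥ 5) (sym size≡) large)))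
      where
      size≡ : partSize (pullback π 𝒫) i ≡ partSize 𝒫 i
      size≡ = partSize-pullback π 𝒫 i

    inProduct-pullback : ∀ ρ → InProduct (pullback π 𝒫) ρ → InProduct 𝒫 (conjugate π ρ)
    inProduct-pullback ρ (σ , σ-factors , ρ≈σ) =
      conjugate π ∘ σ , (λ i → inFactor-pullback i (σ i) (σ-factors i)) ,
      λ z → trans (conjugate-cong {ρ} {prodFamily σ} ρ≈σ z) (conjugate-prodOver σ (allFin n) z)

module _ {G : Perm n → Set} (G≤Sym : IsSubgroup G) where
  open IsSubgroup G≤Sym

  conjugate-closed : ∀ {π σ} → G π → G σ → G (conjugate π σ)
  conjugate-closed π∈G σ∈G = closed-∘ (closed-⁻¹ π∈G) (closed-∘ σ∈G π∈G)

  isASP-pullback : ∀ {π 𝒫} → G π → IsASP G 𝒫 → IsASP G (pullback π 𝒫)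
  isASP-pullback {π} {𝒫} π∈G 𝒫-asp ρ ρ∈∏ =
    respects (conjugate-inverse π ρ)
      (conjugate-closed (closed-⁻¹ π∈G) (𝒫-asp (conjugate π ρ) (inProduct-pullback π 𝒫 ρ ρ∈∏)))

  pullback-refines-coarsest : ∀ {π 𝒫} → G π → IsCoarsestASP G 𝒫 → Refines (pullback π 𝒫) 𝒫
  pullback-refines-coarsest {π} {𝒫} π∈G (𝒫-asp , coarsest) =
    coarsest (pullback π 𝒫) (isASP-pullback π∈G 𝒫-asp)

inStab-of-refines : (𝒫 : Partition n) (π : Perm n) →
  Refines (pullback π 𝒫) 𝒫 → Refines (pullback (flip π) 𝒫) 𝒫 → InStab 𝒫 π
inStab-of-refines 𝒫 π π⁻¹𝒫≤𝒫 π𝒫≤𝒫 a = π ⟨$⟩ʳ a , λ b → mk⇔ (into b) (onto b)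
  where
  into : ∀ b → 𝒫 b ≡ 𝒫 (π ⟨$⟩ʳ a) → Σ (Fin _) λ d → (𝒫 d ≡ 𝒫 a) × (π ⟨$⟩ʳ d ≡ b)
  into b 𝒫b≡𝒫πa = π ⟨$⟩ˡ b , π⁻¹𝒫≤𝒫 _ _ (trans (cong 𝒫 (inverseʳ π)) 𝒫b≡𝒫πa) , inverseʳ π
  onto : ∀ b → Σ (Fin _) (λ d → (𝒫 d ≡ 𝒫 a) × (π ⟨$⟩ʳ d ≡ b)) → 𝒫 b ≡ 𝒫 (π ⟨$⟩ʳ a)
  onto b (d , 𝒫d≡𝒫a , refl) = π𝒫≤𝒫 (π ⟨$⟩ʳ d) (π ⟨$⟩ʳ a)
    (trans (cong 𝒫 (inverseˡ π)) (trans 𝒫d≡𝒫a (cong 𝒫 (sym (inverseˡ π)))))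

lemma8p6 : (n : ℕ) (G : Perm n → Set) → IsSubgroup G →
    (𝒫 : Partition n) → IsCoarsestASP G 𝒫 →
    IsASP G 𝒫 × (∀ π → G π → InStab 𝒫 π)
lemma8p6 n G G≤Sym 𝒫 𝒫-coarsest@(𝒫-asp , _) = 𝒫-asp , λ π π∈G →
  inStab-of-refines 𝒫 π
    (pullback-refines-coarsest G≤Sym π∈G 𝒫-coarsest)
    (pullback-refines-coarsest G≤Sym (IsSubgroup.closed-⁻¹ G≤Sym π∈G) 𝒫-coarsest)
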